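{- Consider schedules for the Linear Tape Scheduling Problem (LTSP) of the following form, specified by a finite sequence of mini-batches $(b_1,\dots,b_p)$: starting at position $m$, for $i=1,\dots,p$ the head moves to $l(b_i)$, then rightwards to $r(b_i)$ and back to $l(b_i)$ (executing $b_i$); afterwards it moves to position $1$ and then rightwards to position $m$, reading every file. For every such schedule that is optimal for LTSP, there is a schedule of this form with the same total response time in which the mini-batches are executed in decreasing order of their leftmost blocks $l(b_i)$.
   Context: Tape model. A single-track tape stores files $f_1,\dots,f_n$ in this order from left to right; positions (blocks) are $1,\dots,m$. File $f$ occupies blocks $l(f),\dots,r(f)$, with $l(f_1)=1$, $l(f_{i+1})=r(f_i)+1$, $r(f_n)=m$; its size is $s(f)=r(f)-l(f)+1\ge 1$. A finite set of read requests is given, each associated with one file. The read head is at position $m$ at time $0$ and moves at unit speed (one block per time step), possibly changing direction. A file $f$ is read when the head traverses it rightwards from $l(f)$ to $r(f)$; the time such a traversal begins is a read time of $f$. In LTSP all requests are released at time $0$; a request is serviced at the first read time of its file, which is its response time; LTSP asks for a head motion minimizing the sum of response times (an optimal schedule). A mini-batch is a pair $b=(f,f')$ of files with $l(f)\le l(f')$, with leftmost block $l(b)=l(f)$ and rightmost block $r(b)=r(f')$. -}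

module Defs where

open import Data.Nat using (ℕ; zero; suc; _+_; _*_; _∸_; _≤_; _<_; _≥_; _≤ᵇ_)
open import Data.Bool using (if_then_else_)
open import Data.Fin using (Fin; zero; suc)
open import Data.List using (List; []; _∷_; _++_; concatMap; map)
open import Data.List.Relation.Unary.Linked using (Linked)
open import Data.Product using (Σ; ∃; _×_; _,_)
open import Data.Sum using (_⊎_)
open import Relation.Nullary using (¬_)
open import Relation.Binary.PropositionalEquality using (_≡_)

-- Tape layout.  Files f_1..f_n are indexed by Fin n (zero = f_1);
-- s i is the size of file i.

prefix : ∀ {n} → (Fin n → ℕ) → Fin n → ℕ
prefix s zero    = 0
prefix s (suc i) = s zero + prefix (λ j → s (suc j)) i

total : ∀ {n} → (Fin n → ℕ) → ℕ
total {zero}  s = 0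
total {suc n} s = s zero + total (λ j → s (suc j))

lft : ∀ {n} → (Fin n → ℕ) → Fin n → ℕ
lft s i = suc (prefix s i)

rgt : ∀ {n} → (Fin n → ℕ) → Fin n → ℕ
rgt s i = prefix s i + s i

-- Head motions: position at each (integer) time step.
-- Starts at m, stays within blocks 1..m, moves at most one block per step.

ValidMotion : ∀ {n} → (Fin n → ℕ) → (ℕ → ℕ) → Set
ValidMotion s h =
  (h 0 ≡ total s) ×
  (∀ t → 1 ≤ h t × h t ≤ total s) ×
  (∀ t → (h (suc t) ≡ h t) ⊎ (h (suc t) ≡ suc (h t)) ⊎ (suc (h (suc t)) ≡ h t))

ReadsAt : ∀ {n} → (Fin n → ℕ) → (ℕ → ℕ) → Fin n → ℕ → Set
ReadsAt s h f t = ∀ k → k < s f → h (t + k) ≡ lft s f + k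

-- t is the first read time (the response time) of f
FirstRead : ∀ {n} → (Fin n → ℕ) → (ℕ → ℕ) → Fin n → ℕ → Set
FirstRead s h f t = ReadsAt s h f t × (∀ t' → t' < t → ¬ ReadsAt s h f t')

Cost : ∀ {n} → (Fin n → ℕ) → (ℕ → ℕ) → List (Fin n) → ℕ → Set
Cost s h []         C = C ≡ 0
Cost s h (f ∷ reqs) C =
  Σ ℕ λ t → Σ ℕ λ C' → FirstRead s h f t × Cost s h reqs C' × (C ≡ t + C')

Optimal : ∀ {n} → (Fin n → ℕ) → List (Fin n) → (ℕ → ℕ) → Set
Optimal s reqs h =
  Σ ℕ λ C → Cost s h reqs C ×
    (∀ h' → ValidMotion s h' → ∀ C' → Cost s h' reqs C' → C ≤ C')

record MiniBatch {n : ℕ} (s : Fin n → ℕ) : Set where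
  constructor mb
  field
    first  : Fin n
    second : Fin n
    ordered : lft s first ≤ lft s second

lb : ∀ {n} {s : Fin n → ℕ} → MiniBatch s → ℕ
lb {s = s} b = lft s (MiniBatch.first b)

rb : ∀ {n} {s : Fin n → ℕ} → MiniBatch s → ℕ
rb {s = s} b = rgt s (MiniBatch.second b)

-- Move from cur by t unit steps towards w, then continue through the
-- remaining waypoints; after the last waypoint, stay put.
walk : ℕ → List ℕ → ℕ → ℕ
walk cur []       t = cur
walk cur (w ∷ ws) t =
  if cur ≤ᵇ w
  then (if t ≤ᵇ (w ∸ cur) then cur + t else walk w ws (t ∸ (w ∸ cur)))
  else (if t ≤ᵇ (cur ∸ w) then cur ∸ t else walk w ws (t ∸ (cur ∸ w)))

waypoints : ∀ {n} (s : Fin n → ℕ) → List (MiniBatch s) → List ℕ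
waypoints s bs = concatMap (λ b → lb b ∷ rb b ∷ lb b ∷ []) bs ++ (1 ∷ total s ∷ [])

batchSchedule : ∀ {n} (s : Fin n → ℕ) → List (MiniBatch s) → ℕ → ℕ
batchSchedule s bs = walk (total s) (waypoints s bs)

DecreasingLeft : ∀ {n} {s : Fin n → ℕ} → List (MiniBatch s) → Set
DecreasingLeft bs = Linked (λ a b → b ≤ a) (map lb bs)

-- Let b be a mini-batch and P the run of mini-batches executed right after b that start at or to
-- the right of l(b). Executing b and P keeps the head inside [l(b), R], where R is the largest
-- right end among them, before it leaves leftwards through l(b); the single mini-batch from l(b)
-- to R climbs through that interval at once, returns to l(b) no later, and so performs every
-- rightward sweep of the original no later. Merging in this way from the last mini-batch to the
-- first gives mini-batches with decreasing left ends and response times that are no larger; by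
-- optimality of the original schedule the total response time is then the same.

module Submission where

open import Defs
open import Data.Bool using (true; false)
open import Data.Fin using (Fin; zero; suc)
open import Data.List using (List; []; _∷_; _++_; _∷ʳ_; concatMap; foldr; head; map; takeWhile; dropWhile)
open import Data.List.Extrema.Nat using (argmax; argmax-all; f[⊥]≤f[argmax]; f[xs]≤f[argmax])
open import Data.List.Membership.Propositional using (_∈_)
open import Data.List.Membership.Propositional.Properties using (∈-++⁺ˡ)
open import Data.List.Properties using (++-assoc; takeWhile++dropWhile)
open import Data.List.Relation.Unary.All as All using (All; []; _∷_)
open import Data.List.Relation.Unary.All.Properties using (++⁺; ∷ʳ⁺; all-takeWhile; all-head-dropWhile)
open import Data.List.Relation.Unary.Any using (here; there)
open import Data.List.Relation.Unary.Linked as Linked using ([]; [-]; _∷_)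
open import Data.Maybe.Relation.Unary.All as Maybe using (just; nothing)
open import Data.Nat
open import Data.Nat.Properties
open import Data.Product using (Σ; _×_; _,_; proj₁; proj₂; ∃-syntax; ∃₂)
open import Data.Sum using (_⊎_; inj₁; inj₂; [_,_]′)
open import Relation.Binary.PropositionalEquality
open import Relation.Nullary using (¬_; yes; no; contradiction; _×-dec_)
open import Relation.Nullary.Reflects using (ofʸ; ofⁿ)
open import Relation.Unary using (Decidable)

-- Head motions through waypoints

≤ᵇ-true : ∀ {m n} → m ≤ n → (m ≤ᵇ n) ≡ true
≤ᵇ-true {m} {n} m≤n with m ≤ᵇ n | ≤ᵇ-reflects-≤ m n
... | true  | _       = refl
... | false | ofⁿ m≰n = contradiction m≤n m≰n

≤ᵇ-false : ∀ {m n} → m ≰ n → (m ≤ᵇ n) ≡ false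
≤ᵇ-false {m} {n} m≰n with m ≤ᵇ n | ≤ᵇ-reflects-≤ m n
... | true  | ofʸ m≤n = contradiction m≤n m≰n
... | false | _       = refl

walk-0 : ∀ c ws → walk c ws 0 ≡ c
walk-0 c []       = refl
walk-0 c (w ∷ ws) with c ≤ᵇ w
... | true  = +-identityʳ c
... | false = refl

walk-up : ∀ {c w} ws {u} → c ≤ w → u ≤ w ∸ c → walk c (w ∷ ws) u ≡ c + u
walk-up ws c≤w u≤ rewrite ≤ᵇ-true c≤w | ≤ᵇ-true u≤ = refl

walk-down : ∀ {c w} ws {u} → w ≤ c → u ≤ c ∸ w → walk c (w ∷ ws) u ≡ c ∸ u
walk-down {c} {w} ws {zero}  _ _  = walk-0 c (w ∷ ws)
walk-down {c} {w} ws {suc u} _ u<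
  rewrite ≤ᵇ-false {c} {w} (<⇒≱ (m∸n≢0⇒n<m (m<n⇒n≢0 u<))) | ≤ᵇ-true u< = refl

walk-reaches : ∀ c w ws → walk c (w ∷ ws) ∣ c - w ∣ ≡ w
walk-reaches c w ws with c ≤? w
... | yes c≤w = begin
  walk c (w ∷ ws) ∣ c - w ∣ ≡⟨ cong (walk c (w ∷ ws)) (m≤n⇒∣m-n∣≡n∸m c≤w) ⟩
  walk c (w ∷ ws) (w ∸ c)   ≡⟨ walk-up ws c≤w ≤-refl ⟩
  c + (w ∸ c)               ≡⟨ m+[n∸m]≡n c≤w ⟩
  w                         ∎
  where open ≡-Reasoning
... | no c≰w = begin
  walk c (w ∷ ws) ∣ c - w ∣ ≡⟨ cong (walk c (w ∷ ws)) (m≤n⇒∣n-m∣≡n∸m w≤c) ⟩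
  walk c (w ∷ ws) (c ∸ w)   ≡⟨ walk-down ws w≤c ≤-refl ⟩
  c ∸ (c ∸ w)               ≡⟨ m∸[m∸n]≡n w≤c ⟩
  w                         ∎
  where
  open ≡-Reasoning
  w≤c = ≰⇒≥ c≰w

walk-after : ∀ c w ws u → walk c (w ∷ ws) (∣ c - w ∣ + u) ≡ walk w ws u
walk-after c w ws zero = begin
  walk c (w ∷ ws) (∣ c - w ∣ + 0) ≡⟨ cong (walk c (w ∷ ws)) (+-identityʳ _) ⟩
  walk c (w ∷ ws) ∣ c - w ∣       ≡⟨ walk-reaches c w ws ⟩
  w                               ≡⟨ walk-0 w ws ⟨
  walk w ws 0                     ∎
  where open ≡-Reasoning
walk-after c w ws (suc u) with c ≤? w
... | yes c≤w
  rewrite m≤n⇒∣m-n∣≡n∸m c≤w | ≤ᵇ-true c≤w | ≤ᵇ-false (m+1+n≰m (w ∸ c) {u}) =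
  cong (walk w ws) (m+n∸m≡n (w ∸ c) (suc u))
... | no c≰w
  rewrite m≤n⇒∣n-m∣≡n∸m (≰⇒≥ c≰w) | ≤ᵇ-false c≰w | ≤ᵇ-false (m+1+n≰m (c ∸ w) {u}) =
  cong (walk w ws) (m+n∸m≡n (c ∸ w) (suc u))

UnitStep : ℕ → ℕ → Set
UnitStep x y = (y ≡ x) ⊎ (y ≡ suc x) ⊎ (suc y ≡ x)

UnitSpeed : (ℕ → ℕ) → Set
UnitSpeed h = ∀ t → UnitStep (h t) (h (suc t))

walk-unitSpeed : ∀ c ws → UnitSpeed (walk c ws)
walk-unitSpeed c []       t = inj₁ refl
walk-unitSpeed c (w ∷ ws) t with ∣ c - w ∣ ≤? t
... | yes d≤t with m≤n⇒∃[o]m+o≡n d≤t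
...   | k , refl = subst₂ UnitStep (sym (walk-after c w ws k)) (sym after-suc) (walk-unitSpeed w ws k)
  where
  after-suc : walk c (w ∷ ws) (suc (∣ c - w ∣ + k)) ≡ walk w ws (suc k)
  after-suc = trans (cong (walk c (w ∷ ws)) (sym (+-suc ∣ c - w ∣ k))) (walk-after c w ws (suc k))
walk-unitSpeed c (w ∷ ws) t | no d≰t with c ≤? w
... | yes c≤w = subst₂ UnitStep (sym (walk-up ws c≤w (<⇒≤ t<))) (sym (walk-up ws c≤w t<))
  (inj₂ (inj₁ (+-suc c t)))
  where t< = subst (t <_) (m≤n⇒∣m-n∣≡n∸m c≤w) (≰⇒> d≰t)
... | no c≰w = subst₂ UnitStep (sym (walk-down ws w≤c (<⇒≤ t<))) (sym (walk-down ws w≤c t<))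
  (inj₂ (inj₂ (sym (+-∸-assoc 1 (≤-trans t< (m∸n≤m c w))))))
  where
  w≤c = ≰⇒≥ c≰w
  t< = subst (t <_) (m≤n⇒∣n-m∣≡n∸m w≤c) (≰⇒> d≰t)

Within : ℕ → ℕ → ℕ → Set
Within a b x = a ≤ x × x ≤ b

within-between : ∀ {a b x y z} → Within a b x → Within a b y → x ≤ z → z ≤ y → Within a b z
within-between (a≤x , _) (_ , y≤b) x≤z z≤y = ≤-trans a≤x x≤z , ≤-trans z≤y y≤b

walk-within : ∀ {a b} c ws → Within a b c → All (Within a b) ws → ∀ u → Within a b (walk c ws u)
walk-within c []       c∈ []           u = c∈
walk-within c (w ∷ ws) c∈ (w∈ ∷ ws∈)  u with ∣ c - w ∣ ≤? u
... | yes d≤u with m≤n⇒∃[o]m+o≡n d≤u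
...   | k , refl = subst (Within _ _) (sym (walk-after c w ws k)) (walk-within w ws w∈ ws∈ k)
walk-within c (w ∷ ws) c∈ (w∈ ∷ ws∈) u | no d≰u with c ≤? w
... | yes c≤w =
  subst (Within _ _) (sym (walk-up ws c≤w u≤)) (within-between c∈ w∈ (m≤m+n c u) c+u≤w)
  where
  u≤ = subst (u ≤_) (m≤n⇒∣m-n∣≡n∸m c≤w) (<⇒≤ (≰⇒> d≰u))
  c+u≤w = ≤-trans (+-monoʳ-≤ c u≤) (≤-reflexive (m+[n∸m]≡n c≤w))
... | no c≰w =
  subst (Within _ _) (sym (walk-down ws w≤c u≤)) (within-between w∈ c∈ w≤c∸u (m∸n≤m c u))
  where
  w≤c = ≰⇒≥ c≰w
  u≤ = subst (u ≤_) (m≤n⇒∣n-m∣≡n∸m w≤c) (<⇒≤ (≰⇒> d≰u))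
  w≤c∸u = ≤-trans (≤-reflexive (sym (m∸[m∸n]≡n w≤c))) (∸-monoʳ-≤ c u≤)

walk-on-leg : ∀ c w X Y {u} → u ≤ ∣ c - w ∣ → walk c (w ∷ X) u ≡ walk c (w ∷ Y) u
walk-on-leg c w X Y {u} u≤d with c ≤? w
... | yes c≤w = trans (walk-up X c≤w u≤) (sym (walk-up Y c≤w u≤))
  where u≤ = subst (u ≤_) (m≤n⇒∣m-n∣≡n∸m c≤w) u≤d
... | no c≰w = trans (walk-down X w≤c u≤) (sym (walk-down Y w≤c u≤))
  where
  w≤c = ≰⇒≥ c≰w
  u≤ = subst (u ≤_) (m≤n⇒∣n-m∣≡n∸m w≤c) u≤d

pathLength : ℕ → List ℕ → ℕ
pathLength c []       = 0
pathLength c (w ∷ ws) = ∣ c - w ∣ + pathLength w ws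

endpoint : ℕ → List ℕ → ℕ
endpoint c []       = c
endpoint c (w ∷ ws) = endpoint w ws

endpoint-∷ʳ : ∀ c A y → endpoint c (A ∷ʳ y) ≡ y
endpoint-∷ʳ c []      y = refl
endpoint-∷ʳ c (w ∷ A) y = endpoint-∷ʳ w A y

walk-++-shift : ∀ c A X u → walk c (A ++ X) (pathLength c A + u) ≡ walk (endpoint c A) X u
walk-++-shift c []      X u = refl
walk-++-shift c (w ∷ A) X u = begin
  walk c (w ∷ A ++ X) (∣ c - w ∣ + pathLength w A + u)
    ≡⟨ cong (walk c (w ∷ A ++ X)) (+-assoc ∣ c - w ∣ _ u) ⟩
  walk c (w ∷ A ++ X) (∣ c - w ∣ + (pathLength w A + u))
    ≡⟨ walk-after c w (A ++ X) _ ⟩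
  walk w (A ++ X) (pathLength w A + u)
    ≡⟨ walk-++-shift w A X u ⟩
  walk (endpoint w A) X u
    ∎
  where open ≡-Reasoning

walk-++-prefix : ∀ c A X Y {u} → u ≤ pathLength c A → walk c (A ++ X) u ≡ walk c (A ++ Y) u
walk-++-prefix c []      X Y {zero} _ = trans (walk-0 c X) (sym (walk-0 c Y))
walk-++-prefix c (w ∷ A) X Y {u} u≤ with ∣ c - w ∣ ≤? u
... | no d≰u = walk-on-leg c w (A ++ X) (A ++ Y) (<⇒≤ (≰⇒> d≰u))
... | yes d≤u with m≤n⇒∃[o]m+o≡n d≤u
...   | k , refl = begin
  walk c (w ∷ A ++ X) (∣ c - w ∣ + k) ≡⟨ walk-after c w (A ++ X) k ⟩
  walk w (A ++ X) k                   ≡⟨ walk-++-prefix w A X Y (+-cancelˡ-≤ ∣ c - w ∣ _ _ u≤) ⟩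
  walk w (A ++ Y) k                   ≡⟨ walk-after c w (A ++ Y) k ⟨
  walk c (w ∷ A ++ Y) (∣ c - w ∣ + k) ∎
  where open ≡-Reasoning

endpoint-distance≤pathLength : ∀ c A → ∣ c - endpoint c A ∣ ≤ pathLength c A
endpoint-distance≤pathLength c []      = ≤-reflexive (∣n-n∣≡0 c)
endpoint-distance≤pathLength c (w ∷ A) =
  ≤-trans (∣-∣-triangle c w (endpoint w A))
          (+-monoʳ-≤ ∣ c - w ∣ (endpoint-distance≤pathLength w A))

visit-distance≤pathLength : ∀ c A {y} → y ∈ A → ∣ c - y ∣ + ∣ y - endpoint c A ∣ ≤ pathLength c A
visit-distance≤pathLength c (w ∷ A) (here refl) =
  +-monoʳ-≤ ∣ c - w ∣ (endpoint-distance≤pathLength w A)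
visit-distance≤pathLength c (w ∷ A) {y} (there y∈A) = begin
  ∣ c - y ∣ + ∣ y - endpoint w A ∣
    ≤⟨ +-monoˡ-≤ _ (∣-∣-triangle c w y) ⟩
  ∣ c - w ∣ + ∣ w - y ∣ + ∣ y - endpoint w A ∣
    ≡⟨ +-assoc ∣ c - w ∣ _ _ ⟩
  ∣ c - w ∣ + (∣ w - y ∣ + ∣ y - endpoint w A ∣)
    ≤⟨ +-monoʳ-≤ ∣ c - w ∣ (visit-distance≤pathLength w A y∈A) ⟩
  ∣ c - w ∣ + pathLength w A
    ∎
  where open ≤-Reasoning

walk-after-down : ∀ {c w} ws u → w ≤ c → walk c (w ∷ ws) (c ∸ w + u) ≡ walk w ws u
walk-after-down {c} {w} ws u w≤c =
  subst (λ d → walk c (w ∷ ws) (d + u) ≡ walk w ws u) (m≤n⇒∣n-m∣≡n∸m w≤c) (walk-after c w ws u)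

∸-split : ∀ {x y w} → w ≤ y → y ≤ x → x ∸ w ≡ (x ∸ y) + (y ∸ w)
∸-split {x} {y} {w} w≤y y≤x = begin
  x ∸ w           ≡⟨ cong (_∸ w) (m∸n+n≡m y≤x) ⟨
  x ∸ y + y ∸ w   ≡⟨ +-∸-assoc (x ∸ y) w≤y ⟩
  x ∸ y + (y ∸ w) ∎
  where open ≡-Reasoning

walk-via : ∀ {x y w} ws → w ≤ y → y ≤ x → ∀ t → walk x (w ∷ ws) t ≡ walk x (y ∷ w ∷ ws) t
walk-via {x} {y} {w} ws w≤y y≤x t with x ∸ w ≤? t
... | yes x∸w≤t with m≤n⇒∃[o]m+o≡n x∸w≤t
...   | k , refl = begin
  walk x (w ∷ ws) (x ∸ w + k)
    ≡⟨ walk-after-down ws k w≤x ⟩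
  walk w ws k
    ≡⟨ walk-after-down ws k w≤y ⟨
  walk y (w ∷ ws) (y ∸ w + k)
    ≡⟨ walk-after-down (w ∷ ws) (y ∸ w + k) y≤x ⟨
  walk x (y ∷ w ∷ ws) (x ∸ y + (y ∸ w + k))
    ≡⟨ cong (walk x (y ∷ w ∷ ws)) (+-assoc (x ∸ y) (y ∸ w) k) ⟨
  walk x (y ∷ w ∷ ws) (x ∸ y + (y ∸ w) + k)
    ≡⟨ cong (λ d → walk x (y ∷ w ∷ ws) (d + k)) (∸-split w≤y y≤x) ⟨
  walk x (y ∷ w ∷ ws) (x ∸ w + k)
    ∎
  where
  open ≡-Reasoning
  w≤x = ≤-trans w≤y y≤x
walk-via {x} {y} {w} ws w≤y y≤x t | no x∸w≰t with x ∸ y ≤? t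
... | no x∸y≰t = trans (walk-down ws (≤-trans w≤y y≤x) (<⇒≤ (≰⇒> x∸w≰t)))
                         (sym (walk-down (w ∷ ws) y≤x (<⇒≤ (≰⇒> x∸y≰t))))
... | yes x∸y≤t with m≤n⇒∃[o]m+o≡n x∸y≤t
...   | v , refl = begin
  walk x (w ∷ ws) (x ∸ y + v)       ≡⟨ walk-down ws (≤-trans w≤y y≤x) (<⇒≤ (≰⇒> x∸w≰t)) ⟩
  x ∸ (x ∸ y + v)                   ≡⟨ ∸-+-assoc x (x ∸ y) v ⟨
  x ∸ (x ∸ y) ∸ v                   ≡⟨ cong (_∸ v) (m∸[m∸n]≡n y≤x) ⟩
  y ∸ v                             ≡⟨ walk-down ws w≤y v≤ ⟨
  walk y (w ∷ ws) v                 ≡⟨ walk-after-down (w ∷ ws) v y≤x ⟨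
  walk x (y ∷ w ∷ ws) (x ∸ y + v)   ∎
  where
  open ≡-Reasoning
  v≤ : v ≤ y ∸ w
  v≤ = +-cancelˡ-≤ (x ∸ y) _ _ (≤-trans (<⇒≤ (≰⇒> x∸w≰t)) (≤-reflexive (∸-split w≤y y≤x)))

walk-∷-cong : ∀ c w X Y → walk w X ≗ walk w Y → walk c (w ∷ X) ≗ walk c (w ∷ Y)
walk-∷-cong c w X Y X≗Y t with c ≤ᵇ w
... | true  with t ≤ᵇ (w ∸ c)
...   | true  = refl
...   | false = X≗Y _
walk-∷-cong c w X Y X≗Y t | false with t ≤ᵇ (c ∸ w)
...   | true  = refl
...   | false = X≗Y _

walk-++-cong : ∀ c A X Y → walk (endpoint c A) X ≗ walk (endpoint c A) Y →
  walk c (A ++ X) ≗ walk c (A ++ Y)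
walk-++-cong c []      X Y X≗Y = X≗Y
walk-++-cong c (w ∷ A) X Y X≗Y = walk-∷-cong c w (A ++ X) (A ++ Y) (walk-++-cong w A X Y X≗Y)

endpoint-within : ∀ {a b} c A → Within a b c → All (Within a b) A → Within a b (endpoint c A)
endpoint-within c []      c∈ []         = c∈
endpoint-within c (w ∷ A) c∈ (w∈ ∷ A∈) = endpoint-within w A w∈ A∈

-- Sweeps and domination

Sweep : (ℕ → ℕ) → ℕ → ℕ → ℕ → Set
Sweep h t l d = h t ≡ l × h (t + d) ≡ l + d

unitStep-rise : ∀ {x y} → UnitStep x y → y ≤ suc x
unitStep-rise (inj₁ refl)        = n≤1+n _
unitStep-rise (inj₂ (inj₁ refl)) = ≤-refl
unitStep-rise (inj₂ (inj₂ refl)) = ≤-trans (n≤1+n _) (n≤1+n _)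

unitSpeed-rise : ∀ {h} → UnitSpeed h → ∀ t k → h (t + k) ≤ h t + k
unitSpeed-rise {h} speed t zero    =
  ≤-reflexive (trans (cong h (+-identityʳ t)) (sym (+-identityʳ (h t))))
unitSpeed-rise {h} speed t (suc k) = begin
  h (t + suc k)   ≡⟨ cong h (+-suc t k) ⟩
  h (suc (t + k)) ≤⟨ unitStep-rise (speed (t + k)) ⟩
  suc (h (t + k)) ≤⟨ s≤s (unitSpeed-rise speed t k) ⟩
  suc (h t + k)   ≡⟨ +-suc (h t) k ⟨
  h t + suc k     ∎
  where open ≤-Reasoning

sweep-inside : ∀ {h t l d} → UnitSpeed h → Sweep h t l d → ∀ {k} → k ≤ d → h (t + k) ≡ l + k
sweep-inside {h} {t} {l} speed (ht , htd) {k} k≤d with m≤n⇒∃[o]m+o≡n k≤d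
... | e , refl = ≤-antisym upper lower
  where
  open ≤-Reasoning
  upper : h (t + k) ≤ l + k
  upper = subst (λ x → h (t + k) ≤ x + k) ht (unitSpeed-rise speed t k)
  lower : l + k ≤ h (t + k)
  lower = +-cancelʳ-≤ e _ _ (begin
    l + k + e       ≡⟨ +-assoc l k e ⟩
    l + (k + e)     ≡⟨ htd ⟨
    h (t + (k + e)) ≡⟨ cong h (+-assoc t k e) ⟨
    h (t + k + e)   ≤⟨ unitSpeed-rise speed (t + k) e ⟩
    h (t + k) + e   ∎)

sweep-split : ∀ {h t l a e} → UnitSpeed h → Sweep h t l (a + e) → Sweep h (t + a) (l + a) e
sweep-split {h} {t} {l} {a} {e} speed sweep@(_ , htd) =
  sweep-inside speed sweep (m≤m+n a e) , (begin
  h (t + a + e)   ≡⟨ cong h (+-assoc t a e) ⟩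
  h (t + (a + e)) ≡⟨ htd ⟩
  l + (a + e)     ≡⟨ +-assoc l a e ⟨
  l + a + e       ∎)
  where open ≡-Reasoning

sweep-join : ∀ {h t l a e} → h t ≡ l → Sweep h (t + a) (l + a) e → Sweep h t l (a + e)
sweep-join {h} {t} {l} {a} {e} ht (_ , htae) = ht , (begin
  h (t + (a + e)) ≡⟨ cong h (+-assoc t a e) ⟨
  h (t + a + e)   ≡⟨ htae ⟩
  l + a + e       ≡⟨ +-assoc l a e ⟩
  l + (a + e)     ∎)
  where open ≡-Reasoning

sweep-from : ∀ {h g} D → (∀ v → h (D + v) ≡ g v) →
  ∀ {t k l d} → t ≡ D + k → Sweep h t l d → Sweep g k l d
sweep-from {h} D shift {k = k} {d = d} refl (hk , hkd) =
  trans (sym (shift k)) hk , trans (sym (shift (k + d))) (trans (cong h (sym (+-assoc D k d))) hkd)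

sweep-to : ∀ {h g} D → (∀ v → h (D + v) ≡ g v) →
  ∀ {t k l d} → t ≡ D + k → Sweep g k l d → Sweep h t l d
sweep-to {h} D shift {k = k} {d = d} refl (gk , gkd) =
  trans (shift k) gk , trans (cong h (+-assoc D k d)) (trans (shift (k + d)) gkd)

record _⊑_ (h g : ℕ → ℕ) : Set where
  field earlier : ∀ {t l d} → Sweep h t l d → ∃[ t' ] t' ≤ t × Sweep g t' l d
open _⊑_

⊑-refl : ∀ {h} → h ⊑ h
⊑-refl .earlier sweep = _ , ≤-refl , sweep

⊑-trans : ∀ {f g h} → f ⊑ g → g ⊑ h → f ⊑ h
⊑-trans f⊑g g⊑h .earlier sweep with earlier f⊑g sweep
... | t₁ , t₁≤t , sweep₁ with earlier g⊑h sweep₁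
...   | t₂ , t₂≤t₁ , sweep₂ = t₂ , ≤-trans t₂≤t₁ t₁≤t , sweep₂

⊑-resp : ∀ {h h' g g'} → h ≗ h' → g ≗ g' → h' ⊑ g' → h ⊑ g
⊑-resp h≗h' g≗g' h'⊑g' .earlier {t} {d = d} (ht , htd)
  with earlier h'⊑g' (trans (sym (h≗h' t)) ht , trans (sym (h≗h' (t + d))) htd)
... | t' , t'≤t , (gt' , gt'd) = t' , t'≤t , trans (g≗g' t') gt' , trans (g≗g' (t' + d)) gt'd

walk-⊑-subst : ∀ c {X X' Y Y'} → X ≡ X' → Y ≡ Y' →
  walk c X ⊑ walk c Y → walk c X' ⊑ walk c Y'
walk-⊑-subst c refl refl X⊑Y = X⊑Y

⊑-glue : ∀ {h h' g g'} D → UnitSpeed h → (∀ u → u ≤ D → h u ≡ h' u) →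
  (∀ v → h (D + v) ≡ g v) → (∀ v → h' (D + v) ≡ g' v) → g ⊑ g' → h ⊑ h'
⊑-glue {h} {h'} {g} {g'} D speed agree shift shift' g⊑g' .earlier {t} {l} {d} sweep
  with D ≤? t
... | yes D≤t with m≤n⇒∃[o]m+o≡n D≤t
...   | k , refl with earlier g⊑g' (sweep-from {h} {g} D shift refl sweep)
...     | k' , k'≤k , sweep' = D + k' , +-monoʳ-≤ D k'≤k , sweep-to {h'} {g'} D shift' refl sweep'
⊑-glue {h} {h'} {g} {g'} D speed agree shift shift' g⊑g' .earlier {t} {l} {d} sweep@(ht , htd)
  | no D≰t with m≤n⇒∃[o]m+o≡n (<⇒≤ (≰⇒> D≰t))
... | a , refl with d ≤? a
...   | yes d≤a = t , ≤-refl , trans (sym (agree t (m≤m+n t a))) ht ,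
                               trans (sym (agree (t + d) (+-monoʳ-≤ t d≤a))) htd
...   | no d≰a with m≤n⇒∃[o]m+o≡n (<⇒≤ (≰⇒> d≰a))
-- The part of the sweep after time D is a sweep of g starting at time 0, which g' cannot advance.
...     | e , refl
  with earlier g⊑g' (sweep-from {h} {g} (t + a) shift (sym (+-identityʳ _)) (sweep-split {h} speed sweep))
...       | .0 , z≤n , sweep' =
  t , ≤-refl , sweep-join {h'} (trans (sym (agree t (m≤m+n t a))) ht)
                               (sweep-to {h'} {g'} (t + a) shift' (sym (+-identityʳ _)) sweep')

-- Until time T, h stays within [lo, hi] and returns to lo, so each of its sweeps ends by T or
-- starts after T; g performs the former during its straight climb from lo, and the latter by
-- following h with a lead of T - T'.
⊑-excursion : ∀ {h g lo hi} T T' → UnitSpeed h → T' ≤ T → h 0 ≡ lo → h T ≡ lo →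
  (∀ u → u ≤ T → Within lo hi (h u)) → (∀ u → lo + u ≤ hi → g u ≡ lo + u) →
  (∀ v → h (T + v) ≡ g (T' + v)) → h ⊑ g
⊑-excursion {h} {g} {lo} {hi} T T' speed T'≤T h0 hT band climb shift
  .earlier {t} {l} {d} sweep@(ht , htd) with T ≤? t
... | yes T≤t with m≤n⇒∃[o]m+o≡n T≤t
...   | k , refl =
  T' + k , +-monoˡ-≤ k T'≤T , sweep-to {g} T' (λ _ → refl) refl (sweep-from {h} T shift refl sweep)
⊑-excursion {h} {g} {lo} {hi} T T' speed T'≤T h0 hT band climb shift
  .earlier {t} {l} {d} sweep@(ht , htd) | no T≰t with t + d ≤? T
... | no t+d≰T = contradiction lo≤l (<⇒≱ (begin-strict
  l         <⟨ m<m+n l (m<n⇒0<n∸m t<T) ⟩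
  l + a     ≡⟨ sweep-inside speed sweep a≤d ⟨
  h (t + a) ≡⟨ cong h (m+[n∸m]≡n (<⇒≤ t<T)) ⟩
  h T       ≡⟨ hT ⟩
  lo        ∎))
  where
  open ≤-Reasoning
  t<T = ≰⇒> T≰t
  a = T ∸ t
  a≤d : a ≤ d
  a≤d = subst (a ≤_) (m+n∸m≡n t d) (∸-monoˡ-≤ t (<⇒≤ (≰⇒> t+d≰T)))
  lo≤l = subst (lo ≤_) ht (proj₁ (band t (<⇒≤ t<T)))
... | yes t+d≤T with m≤n⇒∃[o]m+o≡n (subst (lo ≤_) ht (proj₁ (band t (≤-trans (m≤m+n t d) t+d≤T))))
...   | j , refl = j , j≤t , climb j start≤hi , trans (climb (j + d) end≤hi) (sym (+-assoc lo j d))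
  where
  j≤t : j ≤ t
  j≤t = +-cancelˡ-≤ lo j t (subst₂ _≤_ ht (cong (_+ t) h0) (unitSpeed-rise speed 0 t))
  start≤hi : lo + j ≤ hi
  start≤hi = subst (_≤ hi) ht (proj₂ (band t (≤-trans (m≤m+n t d) t+d≤T)))
  end≤hi : lo + (j + d) ≤ hi
  end≤hi = subst (_≤ hi) (trans htd (+-assoc lo j d)) (proj₂ (band (t + d) t+d≤T))

walk-++-⊑ : ∀ c A X Y → walk (endpoint c A) X ⊑ walk (endpoint c A) Y →
  walk c (A ++ X) ⊑ walk c (A ++ Y)
walk-++-⊑ c A X Y = ⊑-glue (pathLength c A) (walk-unitSpeed c (A ++ X))
  (λ _ → walk-++-prefix c A X Y) (walk-++-shift c A X) (walk-++-shift c A Y)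

-- The way down from the endpoint of A to w passes through lo, so lo may be appended to A
-- (via-lo); the tour through A then ends at lo, and its length T is at least 2 (hi - lo) = T'.
walk-excursion-⊑ : ∀ {lo hi w} c A ws → All (Within lo hi) A → hi ∈ A → w ≤ lo →
  walk c (lo ∷ A ++ w ∷ ws) ⊑ walk c (lo ∷ hi ∷ lo ∷ w ∷ ws)
walk-excursion-⊑ {lo} {hi} {w} c A ws A⊆ hi∈A w≤lo =
  walk-++-⊑ c (lo ∷ []) (A ++ X) (hi ∷ lo ∷ X)
    (⊑-resp via-lo (λ _ → refl)
      (⊑-excursion T T' (walk-unitSpeed lo (A' ++ X)) T'≤T (walk-0 lo (A' ++ X))
                   at-T band climb shift))
  where
  X = w ∷ ws
  A' = A ∷ʳ lo
  T = pathLength lo A'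
  T' = pathLength lo (hi ∷ lo ∷ [])
  lo≤hi = proj₁ (All.lookup A⊆ hi∈A)
  lo∈ : Within lo hi lo
  lo∈ = ≤-refl , lo≤hi
  A'⊆ : All (Within lo hi) A'
  A'⊆ = ∷ʳ⁺ A⊆ lo∈
  via-lo : walk lo (A ++ X) ≗ walk lo (A' ++ X)
  via-lo t = trans
    (walk-++-cong lo A X (lo ∷ X) (walk-via ws w≤lo (proj₁ (endpoint-within lo A lo∈ A⊆))) t)
    (cong (λ B → walk lo B t) (sym (++-assoc A (lo ∷ []) X)))
  shift : ∀ v → walk lo (A' ++ X) (T + v) ≡ walk lo (hi ∷ lo ∷ X) (T' + v)
  shift v = begin
    walk lo (A' ++ X) (T + v)        ≡⟨ walk-++-shift lo A' X v ⟩
    walk (endpoint lo A') X v        ≡⟨ cong (λ x → walk x X v) (endpoint-∷ʳ lo A lo) ⟩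
    walk lo X v                      ≡⟨ walk-++-shift lo (hi ∷ lo ∷ []) X v ⟨
    walk lo (hi ∷ lo ∷ X) (T' + v)   ∎
    where open ≡-Reasoning
  at-T : walk lo (A' ++ X) T ≡ lo
  at-T = begin
    walk lo (A' ++ X) T       ≡⟨ cong (walk lo (A' ++ X)) (+-identityʳ T) ⟨
    walk lo (A' ++ X) (T + 0) ≡⟨ walk-++-shift lo A' X 0 ⟩
    walk (endpoint lo A') X 0 ≡⟨ walk-0 _ X ⟩
    endpoint lo A'            ≡⟨ endpoint-∷ʳ lo A lo ⟩
    lo                        ∎
    where open ≡-Reasoning
  band : ∀ u → u ≤ T → Within lo hi (walk lo (A' ++ X) u)
  band u u≤T = subst (Within lo hi) (walk-++-prefix lo A' [] X u≤T)
    (walk-within lo (A' ++ []) lo∈ (++⁺ A'⊆ []) u)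
  climb : ∀ u → lo + u ≤ hi → walk lo (hi ∷ lo ∷ X) u ≡ lo + u
  climb u lo+u≤hi =
    walk-up (lo ∷ X) lo≤hi (m+n≤o⇒m≤o∸n u (subst (_≤ hi) (+-comm lo u) lo+u≤hi))
  T'≤T : T' ≤ T
  T'≤T = begin
    ∣ lo - hi ∣ + (∣ hi - lo ∣ + 0)
      ≡⟨ cong (∣ lo - hi ∣ +_) (+-identityʳ _) ⟩
    ∣ lo - hi ∣ + ∣ hi - lo ∣
      ≡⟨ cong (λ x → ∣ lo - hi ∣ + ∣ hi - x ∣) (endpoint-∷ʳ lo A lo) ⟨
    ∣ lo - hi ∣ + ∣ hi - endpoint lo A' ∣
      ≤⟨ visit-distance≤pathLength lo A' (∈-++⁺ˡ hi∈A) ⟩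
    T
      ∎
    where open ≤-Reasoning

-- Coalescing mini-batches

module _ {n} {s : Fin n → ℕ} where
  open MiniBatch

  batchWaypoints : List (MiniBatch s) → List ℕ
  batchWaypoints = concatMap (λ b → lb b ∷ rb b ∷ lb b ∷ [])

  waypoints-++ : ∀ P r → waypoints s (P ++ r) ≡ batchWaypoints P ++ waypoints s r
  waypoints-++ []      r = refl
  waypoints-++ (p ∷ P) r = cong (λ ws → lb p ∷ rb p ∷ lb p ∷ ws) (waypoints-++ P r)

  startsAfter? : (b : MiniBatch s) → Decidable (λ (p : MiniBatch s) → lb b ≤ lb p)
  startsAfter? b p = lb b ≤? lb p

  merge : (b : MiniBatch s) (P : List (MiniBatch s)) → All (λ p → lb b ≤ lb p) P → MiniBatch s
  merge b P b≤P = mb (first b) (second (argmax rb b P))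
    (≤-trans (argmax-all rb {P = λ q → lb b ≤ lb q} ≤-refl b≤P) (ordered (argmax rb b P)))

  absorb : MiniBatch s → List (MiniBatch s) → List (MiniBatch s)
  absorb b N = merge b (takeWhile (startsAfter? b) N) (all-takeWhile (startsAfter? b) N)
             ∷ dropWhile (startsAfter? b) N

  coalesce : List (MiniBatch s) → List (MiniBatch s)
  coalesce = foldr absorb []

  dropWhile-below : ∀ {P : MiniBatch s → Set} (P? : Decidable P) {x} →
    (∀ {p} → ¬ P p → lb p ≤ x) → ∀ N → DecreasingLeft N →
    Linked.Linked (λ a b → b ≤ a) (x ∷ map (lb {s = s}) (dropWhile P? N))
  dropWhile-below P? ¬P⇒≤ []      _   = [-]
  dropWhile-below P? ¬P⇒≤ (p ∷ N) dec with P? p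
  ... | yes _  = dropWhile-below P? ¬P⇒≤ N (Linked.tail dec)
  ... | no ¬Pp = ¬P⇒≤ ¬Pp ∷ dec

  coalesce-decreasing : ∀ bs → DecreasingLeft (coalesce bs)
  coalesce-decreasing []       = []
  coalesce-decreasing (b ∷ bs) =
    dropWhile-below (startsAfter? b) ≰⇒≥ (coalesce bs) (coalesce-decreasing bs)

  rb∈batchWaypoints : ∀ P → All (λ p → rb p ∈ batchWaypoints P) P
  rb∈batchWaypoints []      = []
  rb∈batchWaypoints (p ∷ P) =
    there (here refl) ∷ All.map (λ q → there (there (there q))) (rb∈batchWaypoints P)

  waypoints-next : ∀ (b : MiniBatch s) r → Maybe.All (λ p → lb p ≤ lb b) (head r) →
    ∃₂ λ w ws → waypoints s r ≡ w ∷ ws × w ≤ lb b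
  waypoints-next b []      nothing      = 1 , total s ∷ [] , refl , s≤s z≤n
  waypoints-next b (p ∷ r) (just p≤b)  = lb p , _ , refl , p≤b

module _ {n} {s : Fin n → ℕ} (pos : ∀ i → 1 ≤ s i) where
  open MiniBatch

  lft≤rgt : ∀ i → lft s i ≤ rgt s i
  lft≤rgt i = subst (_≤ rgt s i) (+-comm (prefix s i) 1) (+-monoʳ-≤ (prefix s i) (pos i))

  lb≤rb : (b : MiniBatch s) → lb b ≤ rb b
  lb≤rb b = ≤-trans (ordered b) (lft≤rgt (second b))

  batchWaypoints-within : ∀ {lo hi} P → All (λ p → lo ≤ lb p × rb p ≤ hi) P →
    All (Within lo hi) (batchWaypoints P)
  batchWaypoints-within []      []                    = []
  batchWaypoints-within (p ∷ P) ((lo≤p , p≤hi) ∷ P⊆) =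
    p∈ ∷ (≤-trans lo≤p (lb≤rb p) , p≤hi) ∷ p∈ ∷ batchWaypoints-within P P⊆
    where p∈ = lo≤p , ≤-trans (lb≤rb p) p≤hi

  merge-⊑ : ∀ c b P r (b≤P : All (λ p → lb b ≤ lb p) P) {w ws} →
    waypoints s r ≡ w ∷ ws → w ≤ lb b →
    walk c (lb b ∷ rb b ∷ lb b ∷ waypoints s (P ++ r)) ⊑
    walk c (lb b ∷ rb (argmax rb b P) ∷ lb b ∷ waypoints s r)
  -- The waypoint lists are given explicitly: inferring them makes Agda unfold walk.
  merge-⊑ c b P r b≤P {w} {ws} r-starts w≤lo =
    walk-⊑-subst c {X = lo ∷ A ++ w ∷ ws} {Y = lo ∷ hi ∷ lo ∷ w ∷ ws} tour-before tour-after
      (walk-excursion-⊑ {lo} {hi} {w} c A ws A⊆ hi∈A w≤lo)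
    where
    lo = lb b
    hi = rb (argmax rb b P)
    A = rb b ∷ lo ∷ batchWaypoints P
    b≤hi = f[⊥]≤f[argmax] {f = rb} b P
    A⊆ : All (Within lo hi) A
    A⊆ = (lb≤rb b , b≤hi) ∷ (≤-refl , ≤-trans (lb≤rb b) b≤hi)
       ∷ batchWaypoints-within P (All.zip (b≤P , f[xs]≤f[argmax] {f = rb} b P))
    hi∈A : hi ∈ A
    hi∈A = argmax-all rb {P = λ q → rb q ∈ A} (here refl)
      (All.map (λ q → there (there q)) (rb∈batchWaypoints P))
    tour-before : lo ∷ A ++ w ∷ ws ≡ lb b ∷ rb b ∷ lb b ∷ waypoints s (P ++ r)
    tour-before = cong (λ X → lo ∷ rb b ∷ lo ∷ X)
      (sym (trans (waypoints-++ P r) (cong (batchWaypoints P ++_) r-starts)))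
    tour-after : lo ∷ hi ∷ lo ∷ w ∷ ws ≡ lb b ∷ rb (argmax rb b P) ∷ lb b ∷ waypoints s r
    tour-after = cong (λ X → lo ∷ hi ∷ lo ∷ X) (sym r-starts)

  absorb-⊑ : ∀ c b N → walk c (waypoints s (b ∷ N)) ⊑ walk c (waypoints s (absorb b N))
  absorb-⊑ c b N =
    let after? = startsAfter? b
        (w , ws , r-starts , w≤lo) = waypoints-next b _ (Maybe.map ≰⇒≥ (all-head-dropWhile after? N))
    in walk-⊑-subst c {X' = waypoints s (b ∷ N)} {Y' = waypoints s (absorb b N)}
         (cong (λ N' → lb b ∷ rb b ∷ lb b ∷ waypoints s N') (takeWhile++dropWhile after? N)) refl
         (merge-⊑ c b _ _ (all-takeWhile after? N) r-starts w≤lo)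

  coalesce-⊑ : ∀ c bs → walk c (waypoints s bs) ⊑ walk c (waypoints s (coalesce bs))
  coalesce-⊑ c []       = ⊑-refl
  coalesce-⊑ c (b ∷ bs) = ⊑-trans
    (walk-++-⊑ c (lb b ∷ rb b ∷ lb b ∷ []) (waypoints s bs) (waypoints s (coalesce bs))
               (coalesce-⊑ (lb b) bs))
    (absorb-⊑ c b (coalesce bs))

-- Response times

module _ {P : ℕ → Set} (P? : Decidable P) where

  none-or-least-below : ∀ m →
    (∀ u → u < m → ¬ P u) ⊎ ∃[ t ] t < m × P t × (∀ u → u < t → ¬ P u)
  none-or-least-below zero = inj₁ λ _ ()
  none-or-least-below (suc m) with none-or-least-below m
  ... | inj₂ (t , t<m , least) = inj₂ (t , m<n⇒m<1+n t<m , least)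
  ... | inj₁ none with P? m
  ...   | yes Pm = inj₂ (m , ≤-refl , Pm , none)
  ...   | no ¬Pm =
    inj₁ λ u u<1+m → [ none u , (λ { refl → ¬Pm }) ]′ (m≤n⇒m<n∨m≡n (≤-pred u<1+m))

  least : ∀ {t} → P t → ∃[ t₀ ] t₀ ≤ t × P t₀ × (∀ u → u < t₀ → ¬ P u)
  least {t} Pt with none-or-least-below (suc t)
  ... | inj₁ none                   = contradiction Pt (none t ≤-refl)
  ... | inj₂ (t₀ , t₀<1+t , least) = t₀ , ≤-pred t₀<1+t , least

sweep? : ∀ h l d → Decidable (λ t → Sweep h t l d)
sweep? h l d t = (h t ≟ l) ×-dec (h (t + d) ≟ l + d)

module _ {n} {s : Fin n → ℕ} (pos : ∀ i → 1 ≤ s i) where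

  readsAt⇒sweep : ∀ {h f t} → ReadsAt s h f t → Sweep h t (lft s f) (pred (s f))
  readsAt⇒sweep {h} {f} {t} reads =
    trans (cong h (sym (+-identityʳ t))) (trans (reads 0 (pos f)) (+-identityʳ _)) ,
    reads (pred (s f)) (m≤pred[n]⇒suc[m]≤n {{>-nonZero (pos f)}} ≤-refl)

  sweep⇒readsAt : ∀ {h f t} → UnitSpeed h → Sweep h t (lft s f) (pred (s f)) → ReadsAt s h f t
  sweep⇒readsAt speed sweep k k<s = sweep-inside speed sweep (suc[m]≤n⇒m≤pred[n] k<s)

  firstRead-⊑ : ∀ {h g f t} → UnitSpeed g → h ⊑ g → FirstRead s h f t →
    ∃[ t' ] t' ≤ t × FirstRead s g f t'
  firstRead-⊑ {h} {g} {f} {t} speed h⊑g (reads , _) with earlier h⊑g (readsAt⇒sweep {h} {f} {t} reads)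
  ... | t₁ , t₁≤t , sweep₁ with least (sweep? g (lft s f) (pred (s f))) sweep₁
  ...   | t₀ , t₀≤t₁ , sweep₀ , earliest =
    t₀ , ≤-trans t₀≤t₁ t₁≤t , sweep⇒readsAt speed sweep₀ ,
    λ u u<t₀ reads-u → earliest u u<t₀ (readsAt⇒sweep {g} {f} {u} reads-u)

  cost-⊑ : ∀ {h g} → UnitSpeed g → h ⊑ g → ∀ reqs {C} → Cost s h reqs C →
    ∃[ C' ] C' ≤ C × Cost s g reqs C'
  cost-⊑ speed h⊑g []         refl = 0 , z≤n , refl
  cost-⊑ speed h⊑g (f ∷ reqs) (t , C , first , cost , refl)
    with firstRead-⊑ speed h⊑g first | cost-⊑ speed h⊑g reqs cost
  ... | t' , t'≤t , first' | C' , C'≤C , cost' =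
    t' + C' , +-mono-≤ t'≤t C'≤C , (t' , C' , first' , cost' , refl)

  ⊑-optimal : ∀ {h g reqs} → ValidMotion s g → h ⊑ g → (opt : Optimal s reqs h) →
    Cost s g reqs (proj₁ opt)
  ⊑-optimal {g = g} {reqs} valid h⊑g (C , cost , optimal)
    with cost-⊑ (proj₂ (proj₂ valid)) h⊑g reqs cost
  ... | C' , C'≤C , cost' = subst (Cost s g reqs) (≤-antisym C'≤C (optimal g valid C' cost')) cost'

rgt≤total : ∀ {n} (s : Fin n → ℕ) i → rgt s i ≤ total s
rgt≤total s zero    = m≤m+n (s zero) _
rgt≤total s (suc i) = begin
  prefix s (suc i) + s (suc i)     ≡⟨ +-assoc (s zero) _ _ ⟩
  s zero + rgt (λ j → s (suc j)) i ≤⟨ +-monoʳ-≤ (s zero) (rgt≤total (λ j → s (suc j)) i) ⟩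
  total s                          ∎
  where open ≤-Reasoning

total-positive : ∀ {n} {s : Fin n → ℕ} → (∀ i → 1 ≤ s i) → Fin n → 1 ≤ total s
total-positive {s = s} pos f = ≤-trans (s≤s z≤n) (≤-trans (lft≤rgt pos f) (rgt≤total s f))

batchSchedule-valid : ∀ {n} {s : Fin n → ℕ} → (∀ i → 1 ≤ s i) → 1 ≤ total s → ∀ bs →
  ValidMotion s (batchSchedule s bs)
batchSchedule-valid {s = s} pos 1≤m bs =
  walk-0 (total s) (waypoints s bs) ,
  walk-within (total s) (waypoints s bs) (1≤m , ≤-refl) (++⁺ batches⊆ ends⊆) ,
  walk-unitSpeed (total s) (waypoints s bs)
  where
  batches⊆ = batchWaypoints-within pos bs (All.universal (λ b → s≤s z≤n , rgt≤total s _) bs)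
  ends⊆ : All (Within 1 (total s)) (1 ∷ total s ∷ [])
  ends⊆ = (≤-refl , 1≤m) ∷ (1≤m , ≤-refl) ∷ []

proposition1 : (n : ℕ) (s : Fin n → ℕ) → (∀ i → 1 ≤ s i) →
    (reqs : List (Fin n)) (bs : List (MiniBatch s)) →
    Optimal s reqs (batchSchedule s bs) →
    Σ (List (MiniBatch s)) λ bs' → DecreasingLeft bs' ×
      Σ ℕ λ C → Cost s (batchSchedule s bs) reqs C × Cost s (batchSchedule s bs') reqs C
-- Without requests the tape may be empty, but every cost is 0.
proposition1 n s pos []      bs (C , cost , _) = coalesce bs , coalesce-decreasing bs , C , cost , cost
proposition1 n s pos (f ∷ _) bs opt@(C , cost , _) =
  coalesce bs , coalesce-decreasing bs , C , cost ,
  ⊑-optimal pos (batchSchedule-valid pos (total-positive pos f) (coalesce bs))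
                (coalesce-⊑ pos (total s) bs) opt
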